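{- No axiomatic extension of $\mathbf{LV}$ by a set of axioms from $\{\mathbf W,\mathbf C,\mathbf N,\mathbf T,\mathbf S,\mathbf U,\mathbf A\}$ is algebraizable, except $\mathbf{LVCA}$.
   Context: $\mathbf{LV}$ is the smallest finitary consequence relation in the language $\{\land,\lor,\to,\mathbin{\Box\!\!\rightarrow},0,1\}$ containing classical axioms and (L1) $\varphi\mathbin{\Box\!\!\rightarrow}\varphi$, (L2) $((\varphi\mathbin{\Box\!\!\rightarrow}\psi)\wedge(\psi\mathbin{\Box\!\!\rightarrow}\varphi))\to((\varphi\mathbin{\Box\!\!\rightarrow}\gamma)\leftrightarrow(\psi\mathbin{\Box\!\!\rightarrow}\gamma))$, (L3) $((\varphi\vee\psi)\mathbin{\Box\!\!\rightarrow}\varphi)\vee((\varphi\vee\psi)\mathbin{\Box\!\!\rightarrow}\psi)\vee(((\varphi\vee\psi)\mathbin{\Box\!\!\rightarrow}\gamma)\leftrightarrow((\varphi\mathbin{\Box\!\!\rightarrow}\gamma)\wedge(\psi\mathbin{\Box\!\!\rightarrow}\gamma)))$, (L4) $(\varphi\mathbin{\Box\!\!\rightarrow}(\psi\land\gamma))\leftrightarrow((\varphi\mathbin{\Box\!\!\rightarrow}\psi)\land(\varphi\mathbin{\Box\!\!\rightarrow}\gamma))$, closed under modus ponens and: if $\vdash\varphi\to\psi$ then $\vdash(\gamma\mathbin{\Box\!\!\rightarrow}\varphi)\to(\gamma\mathbin{\Box\!\!\rightarrow}\psi)$. With $\neg x:=x\to0$, $\varphi\mathbin{\Diamond\!\!\rightarrow}\psi:=\neg(\varphi\mathbin{\Box\!\!\rightarrow}\neg\psi)$,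 $\Box\varphi:=\neg\varphi\mathbin{\Box\!\!\rightarrow}\varphi$, $\Diamond\varphi:=\neg\Box\neg\varphi$, $\varphi\preccurlyeq\psi:=((\varphi\vee\psi)\mathbin{\Diamond\!\!\rightarrow}(\varphi\vee\psi))\to((\varphi\vee\psi)\mathbin{\Diamond\!\!\rightarrow}\varphi)$, $\varphi\prec\psi:=\neg(\psi\preccurlyeq\varphi)$, the axioms are: ($\mathbf W$) $(\varphi\mathbin{\Box\!\!\rightarrow}\psi)\to(\varphi\to\psi)$; ($\mathbf C$) $((\varphi\mathbin{\Box\!\!\rightarrow}\psi)\to(\varphi\to\psi))\wedge(\varphi\wedge\psi)\to(\varphi\mathbin{\Box\!\!\rightarrow}\psi)$; ($\mathbf N$) $\Box\varphi\to\Diamond\varphi$; ($\mathbf T$) $\Box\varphi\to\varphi$; ($\mathbf S$) $(\varphi\mathbin{\Box\!\!\rightarrow}\psi)\vee(\varphi\mathbin{\Box\!\!\rightarrow}\neg\psi)$; ($\mathbf U$) $(\Diamond\varphi\to\Box\Diamond\varphi)\wedge(\Box\varphi\to\Box\Box\varphi)$; ($\mathbf A$) $((\varphi\preccurlyeq\psi)\to\Box(\varphi\preccurlyeq\psi))\wedge((\varphi\prec\psi)\to\Box(\varphi\prec\psi))$. $\mathbf{LVCA}$ is the extension by $\mathbf C$ and $\mathbf A$. Algebraizable is in the sense of Blok–Pigozzi. -}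

module Defs where

open import Data.Nat using (ℕ)
open import Data.Fin using (Fin; zero; suc)
open import Data.Bool using (Bool; true; false; not; _∧_; _∨_)
open import Data.Product using (Σ; _×_; _,_; proj₁; proj₂)
open import Data.Sum using (_⊎_)
open import Data.Empty using (⊥)
open import Relation.Binary.PropositionalEquality using (_≡_)

infixr 6 _⋀_
infixr 5 _⋁_
infixr 4 _⟶_
infixr 7 _□→_ _◇→_

data Fm (V : Set) : Set where
  var  : V → Fm V
  _⋀_  : Fm V → Fm V → Fm V
  _⋁_  : Fm V → Fm V → Fm V
  _⟶_  : Fm V → Fm V → Fm V
  _□→_ : Fm V → Fm V → Fm V
  𝟘    : Fm V
  𝟙    : Fm V

sub : {V W : Set} → (V → Fm W) → Fm V → Fm W
sub σ (var x)  = σ x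
sub σ (a ⋀ b)  = sub σ a ⋀ sub σ b
sub σ (a ⋁ b)  = sub σ a ⋁ sub σ b
sub σ (a ⟶ b)  = sub σ a ⟶ sub σ b
sub σ (a □→ b) = sub σ a □→ sub σ b
sub σ 𝟘        = 𝟘
sub σ 𝟙        = 𝟙

Form : Set
Form = Fm ℕ

~_ : Form → Form
~ a = a ⟶ 𝟘

_↔_ : Form → Form → Form
a ↔ b = (a ⟶ b) ⋀ (b ⟶ a)

_◇→_ : Form → Form → Form
a ◇→ b = ~ (a □→ ~ b)

□_ : Form → Form
□ a = (~ a) □→ a

◇_ : Form → Form
◇ a = ~ (□ (~ a))

_≼_ : Form → Form → Form
a ≼ b = ((a ⋁ b) ◇→ (a ⋁ b)) ⟶ ((a ⋁ b) ◇→ a)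

_≺_ : Form → Form → Form
a ≺ b = ~ (b ≼ a)

-- Classical axioms: all substitution instances of classical tautologies,
-- i.e. formulas true under every Boolean valuation in which variables and
-- □→-formulas are treated as atoms.

eval : (Form → Bool) → Form → Bool
eval v (var x)  = v (var x)
eval v (a ⋀ b)  = eval v a ∧ eval v b
eval v (a ⋁ b)  = eval v a ∨ eval v b
eval v (a ⟶ b)  = not (eval v a) ∨ eval v b
eval v (a □→ b) = v (a □→ b)
eval v 𝟘        = false
eval v 𝟙        = true

Tautology : Form → Set
Tautology φ = (v : Form → Bool) → eval v φ ≡ true

data LVAx : Form → Set where
  taut : ∀ {φ} → Tautology φ → LVAx φ
  L1 : ∀ φ → LVAx (φ □→ φ)
  L2 : ∀ φ ψ γ → LVAx (((φ □→ ψ) ⋀ (ψ □→ φ)) ⟶ ((φ □→ γ) ↔ (ψ □→ γ)))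
  L3 : ∀ φ ψ γ → LVAx ((((φ ⋁ ψ) □→ φ) ⋁ ((φ ⋁ ψ) □→ ψ))
                        ⋁ (((φ ⋁ ψ) □→ γ) ↔ ((φ □→ γ) ⋀ (ψ □→ γ))))
  L4 : ∀ φ ψ γ → LVAx ((φ □→ (ψ ⋀ γ)) ↔ ((φ □→ ψ) ⋀ (φ □→ γ)))

data Ax : Set where
  W C N T S U A : Ax

data AxInst : Ax → Form → Set where
  W-inst : ∀ φ ψ → AxInst W ((φ □→ ψ) ⟶ (φ ⟶ ψ))
  C-inst : ∀ φ ψ → AxInst C (((φ □→ ψ) ⟶ (φ ⟶ ψ)) ⋀ ((φ ⋀ ψ) ⟶ (φ □→ ψ)))
  N-inst : ∀ φ → AxInst N ((□ φ) ⟶ (◇ φ))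
  T-inst : ∀ φ → AxInst T ((□ φ) ⟶ φ)
  S-inst : ∀ φ ψ → AxInst S ((φ □→ ψ) ⋁ (φ □→ ~ ψ))
  U-inst : ∀ φ → AxInst U (((◇ φ) ⟶ (□ (◇ φ))) ⋀ ((□ φ) ⟶ (□ (□ φ))))
  A-inst : ∀ φ ψ → AxInst A (((φ ≼ ψ) ⟶ (□ (φ ≼ ψ))) ⋀ ((φ ≺ ψ) ⟶ (□ (φ ≺ ψ))))

-- The consequence relation LV + X, for X ⊆ {W,C,N,T,S,U,A} given by its
-- characteristic function.  Γ ⊢ φ is written  Deriv X Γ φ.

∅ : Form → Set
∅ _ = ⊥

data Deriv (X : Ax → Bool) (Γ : Form → Set) : Form → Set where
  hyp   : ∀ {φ} → Γ φ → Deriv X Γ φ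
  base  : ∀ {φ} → LVAx φ → Deriv X Γ φ
  extra : ∀ {φ} (a : Ax) → X a ≡ true → AxInst a φ → Deriv X Γ φ
  mp    : ∀ {φ ψ} → Deriv X Γ φ → Deriv X Γ (φ ⟶ ψ) → Deriv X Γ ψ
  rck   : ∀ {φ ψ γ} → Deriv X ∅ (φ ⟶ ψ) → Deriv X Γ ((γ □→ φ) ⟶ (γ □→ ψ))

CA : Ax → Bool
CA C = true
CA A = true
CA _ = false

-- Blok–Pigozzi algebraizability (intrinsic characterization, BP Thm 4.7):
-- a set Δ(x,y) of formulas in two variables and a set E(x) of equations in
-- one variable (both possibly infinite, indexed by I and J).

σ₂ : Form → Form → Fin 2 → Form
σ₂ φ ψ zero       = φ
σ₂ φ ψ (suc zero) = ψ

_∪_ : (Form → Set) → (Form → Set) → Form → Set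
(P ∪ Q) χ = P χ ⊎ Q χ

⟦_⟧ : Form → Form → Set
⟦ φ ⟧ χ = χ ≡ φ

data BinOp : Set where
  and or imp cf : BinOp

app : BinOp → Form → Form → Form
app and a b = a ⋀ b
app or  a b = a ⋁ b
app imp a b = a ⟶ b
app cf  a b = a □→ b

record Algebraizable (X : Ax → Bool) : Set₁ where
  field
    I : Set
    J : Set
    Δ : I → Fm (Fin 2)
    E : J → Fm (Fin 1) × Fm (Fin 1)

  Δ[_,_] : Form → Form → Form → Set
  Δ[ φ , ψ ] χ = Σ I λ i → sub (σ₂ φ ψ) (Δ i) ≡ χ

  ΔE[_] : Form → Form → Set
  ΔE[ φ ] χ = Σ J λ j → Δ[ sub (λ _ → φ) (proj₁ (E j)) , sub (λ _ → φ) (proj₂ (E j)) ] χ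

  field
    refl-Δ  : ∀ φ i → Deriv X ∅ (sub (σ₂ φ φ) (Δ i))
    sym-Δ   : ∀ φ ψ i → Deriv X Δ[ φ , ψ ] (sub (σ₂ ψ φ) (Δ i))
    trans-Δ : ∀ φ ψ χ i → Deriv X (Δ[ φ , ψ ] ∪ Δ[ ψ , χ ]) (sub (σ₂ φ χ) (Δ i))
    cong-Δ  : ∀ o φ₁ ψ₁ φ₂ ψ₂ i →
              Deriv X (Δ[ φ₁ , ψ₁ ] ∪ Δ[ φ₂ , ψ₂ ]) (sub (σ₂ (app o φ₁ φ₂) (app o ψ₁ ψ₂)) (Δ i))
    alg₁    : ∀ φ χ → ΔE[ φ ] χ → Deriv X ⟦ φ ⟧ χ
    alg₂    : ∀ φ → Deriv X ΔE[ φ ] φ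

SameLogic : (Ax → Bool) → (Ax → Bool) → Set₁
SameLogic X Y = ∀ Γ φ → (Deriv X Γ φ → Deriv Y Γ φ) × (Deriv Y Γ φ → Deriv X Γ φ)

-- If C and A are derivable, then ¬ φ yields θ = ¬ φ ≺ φ by centering, θ is necessary by A,
-- and φ refutes θ; so a false antecedent is impossible and φ □→ ψ collapses to φ ⟶ ψ.  The
-- logic is then classical logic with □→ read as ⟶, algebraized by x ↔ y and x ≈ 1.  With W
-- and S, C is derivable.  Every other extension is sound for a two-world sphere frame.  There
-- the filter G₁ of propositions containing world 1 has the identity as Leibniz congruence
-- (Δ-equivalence modulo G₁): with x valued {1}, (¬ x □→ –) evaluated at world 1 reads off
-- world 2.  As an algebraizable logic recovers each filter G as {a | E(a) ⊆ Ω G}, the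
-- inclusion Ω G₁ ⊆ Ω {⊤} would give G₁ ⊆ {⊤}, which is false.
module Submission where

open import Defs
open import Data.Bool using (Bool; true; false; not; _∧_; _∨_; if_then_else_; _≟_)
open import Data.Bool.Properties using (⇔→≡)
open import Data.Empty using (⊥; ⊥-elim)
open import Data.Fin using (Fin; zero; suc)
open import Data.Nat using (ℕ; zero; suc; _+_)
open import Data.Product using (Σ; _×_; _,_; -,_; proj₁; proj₂)
open import Data.Product.Properties using (≡-dec)
open import Data.Sum using (inj₁; inj₂; [_,_])
open import Data.Unit using (⊤; tt)
open import Data.Vec using (Vec; []; _∷_; lookup; map)
open import Data.Vec.Properties using (lookup-map)
open import Function using (mk⇔)
open import Level using (0ℓ)
open import Relation.Binary.PropositionalEquality using (_≡_; refl; sym; trans; cong; cong₂; subst)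
open import Relation.Nullary using (Dec; ¬_; yes; no; does)
open import Relation.Nullary.Decidable using (map′; _×-dec_; _→-dec_; True; toWitness; from-yes)
open import Relation.Unary using (Pred; Decidable)

Exhaustible : Set → Set₁
Exhaustible Y = ∀ {P : Pred Y 0ℓ} → Decidable P → Dec (∀ y → P y)

∀-Bool? : Exhaustible Bool
∀-Bool? P? = map′ (λ (t , f) → λ { true → t ; false → f }) (λ h → h true , h false)
                  (P? true ×-dec P? false)

∀-×? : ∀ {Y Z} → Exhaustible Y → Exhaustible Z → Exhaustible (Y × Z)
∀-×? ∀Y? ∀Z? P? = map′ (λ h (y , z) → h y z) (λ h y z → h (y , z)) (∀Y? λ y → ∀Z? λ z → P? (y , z))

∀-Vec? : ∀ {Y} → Exhaustible Y → ∀ n → Exhaustible (Vec Y n)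
∀-Vec? ∀Y? zero    P? = map′ (λ { p [] → p }) (λ h → h []) (P? [])
∀-Vec? ∀Y? (suc n) P? = map′ (λ { h (y ∷ ys) → h y ys }) (λ h y ys → h (y ∷ ys))
                              (∀Y? λ y → ∀-Vec? ∀Y? n λ ys → P? (y ∷ ys))

-- Truth-table tautologies

infixr 6 _&_
infixr 5 _∥_
infixr 4 _⇒_ _⇔_

data PropForm (n : ℕ) : Set where
  atom        : Fin n → PropForm n
  _&_ _∥_ _⇒_ : PropForm n → PropForm n → PropForm n
  ⊥ₚ ⊤ₚ       : PropForm n

¬ₚ_ : ∀ {n} → PropForm n → PropForm n
¬ₚ p = p ⇒ ⊥ₚ

_⇔_ : ∀ {n} → PropForm n → PropForm n → PropForm n
p ⇔ q = (p ⇒ q) & (q ⇒ p)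

x₀ : ∀ {n} → PropForm (1 + n)
x₀ = atom zero
x₁ : ∀ {n} → PropForm (2 + n)
x₁ = atom (suc zero)
x₂ : ∀ {n} → PropForm (3 + n)
x₂ = atom (suc (suc zero))
x₃ : ∀ {n} → PropForm (4 + n)
x₃ = atom (suc (suc (suc zero)))
x₄ : ∀ {n} → PropForm (5 + n)
x₄ = atom (suc (suc (suc (suc zero))))
x₅ : ∀ {n} → PropForm (6 + n)
x₅ = atom (suc (suc (suc (suc (suc zero)))))

truth : ∀ {n} → PropForm n → Vec Bool n → Bool
truth (atom i) β = lookup β i
truth (p & q)  β = truth p β ∧ truth q β
truth (p ∥ q)  β = truth p β ∨ truth q β
truth (p ⇒ q)  β = not (truth p β) ∨ truth q β
truth ⊥ₚ       β = false
truth ⊤ₚ       β = true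

inst : ∀ {n} → PropForm n → Vec Form n → Form
inst (atom i) ρ = lookup ρ i
inst (p & q)  ρ = inst p ρ ⋀ inst q ρ
inst (p ∥ q)  ρ = inst p ρ ⋁ inst q ρ
inst (p ⇒ q)  ρ = inst p ρ ⟶ inst q ρ
inst ⊥ₚ       ρ = 𝟘
inst ⊤ₚ       ρ = 𝟙

IsTautology : ∀ {n} → PropForm n → Set
IsTautology p = ∀ β → truth p β ≡ true

tautology? : ∀ {n} (p : PropForm n) → Dec (IsTautology p)
tautology? {n} p = ∀-Vec? ∀-Bool? n λ β → truth p β ≟ true

eval-inst : ∀ {n} (p : PropForm n) ρ v → eval v (inst p ρ) ≡ truth p (map (eval v) ρ)
eval-inst (atom i) ρ v = sym (lookup-map i (eval v) ρ)
eval-inst (p & q)  ρ v = cong₂ _∧_ (eval-inst p ρ v) (eval-inst q ρ v)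
eval-inst (p ∥ q)  ρ v = cong₂ _∨_ (eval-inst p ρ v) (eval-inst q ρ v)
eval-inst (p ⇒ q)  ρ v = cong₂ (λ a b → not a ∨ b) (eval-inst p ρ v) (eval-inst q ρ v)
eval-inst ⊥ₚ       ρ v = refl
eval-inst ⊤ₚ       ρ v = refl

-- The hidden argument reduces to ⊤ once the truth table has been computed, so Agda fills it in.
tautology : ∀ {X Γ n} (p : PropForm n) (ρ : Vec Form n) → {True (tautology? p)} → Deriv X Γ (inst p ρ)
tautology p ρ {t} = base (taut λ v → trans (eval-inst p ρ v) (toWitness t (map (eval v) ρ)))

module _ {X : Ax → Bool} {Γ : Form → Set} where

  ∧-elimˡ : ∀ {a b} → Deriv X Γ (a ⋀ b) → Deriv X Γ a
  ∧-elimˡ {a} {b} d = mp d (tautology (x₀ & x₁ ⇒ x₀) (a ∷ b ∷ []))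

  ∧-elimʳ : ∀ {a b} → Deriv X Γ (a ⋀ b) → Deriv X Γ b
  ∧-elimʳ {a} {b} d = mp d (tautology (x₀ & x₁ ⇒ x₁) (a ∷ b ∷ []))

  ∧-intro : ∀ {a b} → Deriv X Γ a → Deriv X Γ b → Deriv X Γ (a ⋀ b)
  ∧-intro {a} {b} d e = mp e (mp d (tautology (x₀ ⇒ x₁ ⇒ x₀ & x₁) (a ∷ b ∷ [])))

  ⟶-trans : ∀ {a b c} → Deriv X Γ (a ⟶ b) → Deriv X Γ (b ⟶ c) → Deriv X Γ (a ⟶ c)
  ⟶-trans {a} {b} {c} d e = mp e (mp d (tautology ((x₀ ⇒ x₁) ⇒ (x₁ ⇒ x₂) ⇒ (x₀ ⇒ x₂)) (a ∷ b ∷ c ∷ [])))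

  □→-explosion : ∀ φ ψ → Deriv X Γ ((φ □→ 𝟘) ⟶ (φ □→ ψ))
  □→-explosion φ ψ = rck (tautology (⊥ₚ ⇒ x₀) (ψ ∷ []))

  □⟶~□→𝟘 : ∀ θ → Deriv X Γ (□ θ ⟶ (~ θ □→ 𝟘))
  □⟶~□→𝟘 θ =
    mp (base (L1 (~ θ))) (mp (base (L4 (~ θ) θ (~ θ))) (mp (rck (tautology (x₀ & ¬ₚ x₀ ⇒ ⊥ₚ) (θ ∷ [])))
      (tautology ((x₂ ⇒ x₃) ⇒ (x₂ ⇔ x₀ & x₁) ⇒ x₁ ⇒ (x₀ ⇒ x₃))
        ((~ θ □→ θ) ∷ (~ θ □→ ~ θ) ∷ (~ θ □→ (θ ⋀ ~ θ)) ∷ (~ θ □→ 𝟘) ∷ []))))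

  -- If s is impossible then s □→ b, and b □→ s holds since b implies s; so L2 makes b as
  -- impossible as s.
  □→𝟘-antitone : ∀ {b s} → Deriv X ∅ (b ⟶ s) → Deriv X Γ ((s □→ 𝟘) ⟶ (b □→ 𝟘))
  □→𝟘-antitone {b} {s} b⟶s =
    mp (□→-explosion s b) (mp (base (L1 b)) (mp (rck b⟶s) (mp (base (L2 s b 𝟘))
      (tautology ((x₀ & x₁ ⇒ (x₂ ⇔ x₃)) ⇒ (x₄ ⇒ x₁) ⇒ x₄ ⇒ (x₂ ⇒ x₀) ⇒ (x₂ ⇒ x₃))
        ((s □→ b) ∷ (b □→ s) ∷ (s □→ 𝟘) ∷ (b □→ 𝟘) ∷ (b □→ b) ∷ [])))))

weaken : ∀ {X Γ φ} → Deriv X ∅ φ → Deriv X Γ φ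
weaken (hyp ())
weaken (base l)      = base l
weaken (extra a x i) = extra a x i
weaken (mp d e)      = mp (weaken d) (weaken e)
weaken (rck d)       = rck d

Derives : (Ax → Bool) → Ax → Set
Derives X a = ∀ {φ} → AxInst a φ → Deriv X ∅ φ

translate : ∀ {X Y} → (∀ {a} → Y a ≡ true → Derives X a) → ∀ {Γ φ} → Deriv Y Γ φ → Deriv X Γ φ
translate t (hyp h)       = hyp h
translate t (base l)      = base l
translate t (extra a y i) = weaken (t y i)
translate t (mp d e)      = mp (translate t d) (translate t e)
translate t (rck d)       = rck (translate t d)

C-from-W-S : ∀ {X} → X W ≡ true → X S ≡ true → Derives X C
C-from-W-S w s (C-inst φ ψ) =
  mp (extra W w (W-inst φ ψ)) (mp (extra W w (W-inst φ (~ ψ))) (mp (extra S s (S-inst φ ψ))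
    (tautology ((x₂ ∥ x₃) ⇒ (x₃ ⇒ x₀ ⇒ ¬ₚ x₁) ⇒ (x₂ ⇒ x₀ ⇒ x₁) ⇒ ((x₂ ⇒ x₀ ⇒ x₁) & (x₀ & x₁ ⇒ x₂)))
      (φ ∷ ψ ∷ (φ □→ ψ) ∷ (φ □→ ~ ψ) ∷ []))))

-- Extensions deriving C and A

module CA-Extension {X : Ax → Bool} (derives-C : Derives X C) (derives-A : Derives X A) where

  weak-centering : ∀ a b → Deriv X ∅ ((a □→ b) ⟶ (a ⟶ b))
  weak-centering a b = ∧-elimˡ (derives-C (C-inst a b))

  strong-centering : ∀ a b → Deriv X ∅ ((a ⋀ b) ⟶ (a □→ b))
  strong-centering a b = ∧-elimʳ (derives-C (C-inst a b))

  impossible-if-false : ∀ φ → Deriv X ∅ (~ φ ⟶ (φ □→ 𝟘))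
  impossible-if-false φ =
    ⟶-trans ¬φ⟶θ (⟶-trans (∧-elimʳ (derives-A (A-inst (~ φ) φ)))
      (⟶-trans (□⟶~□→𝟘 θ) (□→𝟘-antitone φ⟶¬θ)))
    where
    D θ : Form
    D = φ ⋁ ~ φ
    θ = (~ φ) ≺ φ
    Dₚ θₚ : PropForm 3
    Dₚ = x₀ ∥ ¬ₚ x₀
    θₚ = ¬ₚ (¬ₚ x₁ ⇒ ¬ₚ x₂)
    atoms : Vec Form 3
    atoms = φ ∷ (D □→ ~ D) ∷ (D □→ ~ φ) ∷ []
    ¬φ⟶θ : Deriv X ∅ (~ φ ⟶ θ)
    ¬φ⟶θ = mp (weak-centering D (~ D)) (mp (strong-centering D (~ φ))
      (tautology (((Dₚ & ¬ₚ x₀) ⇒ x₂) ⇒ (x₁ ⇒ Dₚ ⇒ ¬ₚ Dₚ) ⇒ (¬ₚ x₀ ⇒ θₚ)) atoms))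
    φ⟶¬θ : Deriv X ∅ (φ ⟶ ~ θ)
    φ⟶¬θ = mp (weak-centering D (~ φ)) (tautology ((x₂ ⇒ Dₚ ⇒ ¬ₚ x₀) ⇒ (x₀ ⇒ ¬ₚ θₚ)) atoms)

  collapse : ∀ φ ψ → Deriv X ∅ ((φ □→ ψ) ↔ (φ ⟶ ψ))
  collapse φ ψ =
    mp (weak-centering φ ψ) (mp (strong-centering φ ψ)
      (mp (⟶-trans (impossible-if-false φ) (□→-explosion φ ψ))
        (tautology ((¬ₚ x₀ ⇒ x₂) ⇒ (x₀ & x₁ ⇒ x₂) ⇒ (x₂ ⇒ x₀ ⇒ x₁) ⇒ (x₂ ⇔ (x₀ ⇒ x₁)))
          (φ ∷ ψ ∷ (φ □→ ψ) ∷ []))))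

  □-elim : ∀ φ → Deriv X ∅ (□ φ ⟶ φ)
  □-elim φ = mp (weak-centering (~ φ) φ) (tautology ((x₁ ⇒ ¬ₚ x₀ ⇒ x₀) ⇒ (x₁ ⇒ x₀)) (φ ∷ □ φ ∷ []))

  □-intro : ∀ φ → Deriv X ∅ (φ ⟶ □ φ)
  □-intro φ = mp (collapse (~ φ) φ) (tautology ((x₁ ⇔ (¬ₚ x₀ ⇒ x₀)) ⇒ (x₀ ⇒ x₁)) (φ ∷ □ φ ∷ []))

  derives-all : ∀ a → Derives X a
  derives-all W (W-inst φ ψ) = weak-centering φ ψ
  derives-all C i            = derives-C i
  derives-all N (N-inst φ)   = mp (□-elim φ) (mp (□-elim (~ φ))
    (tautology ((x₂ ⇒ ¬ₚ x₀) ⇒ (x₁ ⇒ x₀) ⇒ (x₁ ⇒ ¬ₚ x₂)) (φ ∷ □ φ ∷ □ (~ φ) ∷ [])))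
  derives-all T (T-inst φ)   = □-elim φ
  derives-all S (S-inst φ ψ) = mp (collapse φ ψ) (mp (collapse φ (~ ψ))
    (tautology ((x₃ ⇔ (x₀ ⇒ ¬ₚ x₁)) ⇒ (x₂ ⇔ (x₀ ⇒ x₁)) ⇒ (x₂ ∥ x₃))
      (φ ∷ ψ ∷ (φ □→ ψ) ∷ (φ □→ ~ ψ) ∷ [])))
  derives-all U (U-inst φ)   = ∧-intro (□-intro (◇ φ)) (□-intro (□ φ))
  derives-all A i            = derives-A i

  ↔-congruent : ∀ o φ₁ ψ₁ φ₂ ψ₂ → Deriv X ∅ ((φ₁ ↔ ψ₁) ⟶ (φ₂ ↔ ψ₂) ⟶ (app o φ₁ φ₂ ↔ app o ψ₁ ψ₂))
  ↔-congruent and φ₁ ψ₁ φ₂ ψ₂ =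
    tautology ((x₀ ⇔ x₁) ⇒ (x₂ ⇔ x₃) ⇒ (x₀ & x₂ ⇔ x₁ & x₃)) (φ₁ ∷ ψ₁ ∷ φ₂ ∷ ψ₂ ∷ [])
  ↔-congruent or  φ₁ ψ₁ φ₂ ψ₂ =
    tautology ((x₀ ⇔ x₁) ⇒ (x₂ ⇔ x₃) ⇒ (x₀ ∥ x₂ ⇔ x₁ ∥ x₃)) (φ₁ ∷ ψ₁ ∷ φ₂ ∷ ψ₂ ∷ [])
  ↔-congruent imp φ₁ ψ₁ φ₂ ψ₂ =
    tautology ((x₀ ⇔ x₁) ⇒ (x₂ ⇔ x₃) ⇒ ((x₀ ⇒ x₂) ⇔ (x₁ ⇒ x₃))) (φ₁ ∷ ψ₁ ∷ φ₂ ∷ ψ₂ ∷ [])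
  ↔-congruent cf  φ₁ ψ₁ φ₂ ψ₂ = mp (collapse φ₁ φ₂) (mp (collapse ψ₁ ψ₂)
    (tautology ((x₅ ⇔ (x₁ ⇒ x₃)) ⇒ (x₄ ⇔ (x₀ ⇒ x₂)) ⇒ (x₀ ⇔ x₁) ⇒ (x₂ ⇔ x₃) ⇒ (x₄ ⇔ x₅))
      (φ₁ ∷ ψ₁ ∷ φ₂ ∷ ψ₂ ∷ (φ₁ □→ φ₂) ∷ (ψ₁ □→ ψ₂) ∷ [])))

  algebraizable : Algebraizable X
  algebraizable = record
    { I       = ⊤
    ; J       = ⊤
    ; Δ       = λ _ → (var zero ⟶ var (suc zero)) ⋀ (var (suc zero) ⟶ var zero)
    ; E       = λ _ → var zero , 𝟙
    ; refl-Δ  = λ φ _ → tautology (x₀ ⇔ x₀) (φ ∷ [])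
    ; sym-Δ   = λ φ ψ _ → mp (hyp (tt , refl)) (tautology ((x₀ ⇔ x₁) ⇒ (x₁ ⇔ x₀)) (φ ∷ ψ ∷ []))
    ; trans-Δ = λ φ ψ χ _ → mp (hyp (inj₂ (tt , refl))) (mp (hyp (inj₁ (tt , refl)))
                  (tautology ((x₀ ⇔ x₁) ⇒ (x₁ ⇔ x₂) ⇒ (x₀ ⇔ x₂)) (φ ∷ ψ ∷ χ ∷ [])))
    ; cong-Δ  = λ o φ₁ ψ₁ φ₂ ψ₂ _ → mp (hyp (inj₂ (tt , refl))) (mp (hyp (inj₁ (tt , refl)))
                  (weaken (↔-congruent o φ₁ ψ₁ φ₂ ψ₂)))
    ; alg₁    = λ { φ _ (_ , _ , refl) → mp (hyp refl) (tautology (x₀ ⇒ (x₀ ⇔ ⊤ₚ)) (φ ∷ [])) }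
    ; alg₂    = λ φ → mp (hyp (tt , tt , refl)) (tautology ((x₀ ⇔ ⊤ₚ) ⇒ x₀) (φ ∷ []))
    }

same-logic-as-LVCA : ∀ {X} → Derives X C → Derives X A → SameLogic X CA
same-logic-as-LVCA derives-C derives-A Γ φ =
  translate (λ {a} _ → LVCA.derives-all a) ,
  translate (λ {a} _ → CA-Extension.derives-all derives-C derives-A a)
  where module LVCA = CA-Extension {CA} (extra C refl) (extra A refl)

-- Two-world sphere models

infixr 10 _□→ᴬ[_]_
infixr 9 _∧ᴬ_
infixr 8 _∨ᴬ_
infixr 7 _⇒ᴬ_ _⇒ᵇ_
infix  3 _≟ᴬ_

_⇒ᵇ_ : Bool → Bool → Bool
a ⇒ᵇ b = not a ∨ b

-- A proposition is a set of worlds: coordinate i says whether world i belongs to it.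
𝔸 : Set
𝔸 = Bool × Bool

_∧ᴬ_ _∨ᴬ_ _⇒ᴬ_ : 𝔸 → 𝔸 → 𝔸
(a₁ , a₂) ∧ᴬ (b₁ , b₂) = a₁ ∧ b₁ , a₂ ∧ b₂
(a₁ , a₂) ∨ᴬ (b₁ , b₂) = a₁ ∨ b₁ , a₂ ∨ b₂
(a₁ , a₂) ⇒ᴬ (b₁ , b₂) = a₁ ⇒ᵇ b₁ , a₂ ⇒ᵇ b₂

⊥ᴬ ⊤ᴬ : 𝔸
⊥ᴬ = false , false
⊤ᴬ = true , true

_≟ᴬ_ : (a b : 𝔸) → Dec (a ≡ b)
_≟ᴬ_ = ≡-dec _≟_ _≟_

∀-𝔸? : Exhaustible 𝔸
∀-𝔸? = ∀-×? ∀-Bool? ∀-Bool?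

-- The three total preorders on the two worlds.
data Ranking : Set where
  tie closer₁ closer₂ : Ranking

∀-Ranking? : Exhaustible Ranking
∀-Ranking? P? = map′ (λ (t , c₁ , c₂) → λ { tie → t ; closer₁ → c₁ ; closer₂ → c₂ })
                     (λ h → h tie , h closer₁ , h closer₂)
                     (P? tie ×-dec P? closer₁ ×-dec P? closer₂)

-- Lewis' clause at a world ranking the worlds by r: the closest a-worlds are b-worlds.
closest-are : Ranking → 𝔸 → 𝔸 → Bool
closest-are tie     (a₁ , a₂) (b₁ , b₂) = (a₁ ⇒ᵇ b₁) ∧ (a₂ ⇒ᵇ b₂)
closest-are closer₁ (a₁ , a₂) (b₁ , b₂) = if a₁ then b₁ else (a₂ ⇒ᵇ b₂)
closest-are closer₂ (a₁ , a₂) (b₁ , b₂) = if a₂ then b₂ else (a₁ ⇒ᵇ b₁)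

-- The rankings seen from world 1 and from world 2.
Frame : Set
Frame = Ranking × Ranking

∀-Frame? : Exhaustible Frame
∀-Frame? = ∀-×? ∀-Ranking? ∀-Ranking?

_□→ᴬ[_]_ : 𝔸 → Frame → 𝔸 → 𝔸
a □→ᴬ[ r₁ , r₂ ] b = closest-are r₁ a b , closest-are r₂ a b

□→ᴬ-world₂ : ∀ F b → proj₁ ((false , true) □→ᴬ[ F ] b) ≡ proj₂ b
□→ᴬ-world₂ (tie     , _) b = refl
□→ᴬ-world₂ (closer₁ , _) b = refl
□→ᴬ-world₂ (closer₂ , _) b = refl

□→ᴬ-monotone : ∀ F a b c → a ⇒ᴬ b ≡ ⊤ᴬ → (c □→ᴬ[ F ] a) ⇒ᴬ (c □→ᴬ[ F ] b) ≡ ⊤ᴬ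
□→ᴬ-monotone = from-yes (∀-Frame? λ F → ∀-𝔸? λ a → ∀-𝔸? λ b → ∀-𝔸? λ c →
  (a ⇒ᴬ b ≟ᴬ ⊤ᴬ) →-dec ((c □→ᴬ[ F ] a) ⇒ᴬ (c □→ᴬ[ F ] b) ≟ᴬ ⊤ᴬ))

module Semantics (F : Frame) where

  ⟪_⟫ : ∀ {V} → Fm V → (V → 𝔸) → 𝔸
  ⟪ var x  ⟫ ρ = ρ x
  ⟪ a ⋀ b  ⟫ ρ = ⟪ a ⟫ ρ ∧ᴬ ⟪ b ⟫ ρ
  ⟪ a ⋁ b  ⟫ ρ = ⟪ a ⟫ ρ ∨ᴬ ⟪ b ⟫ ρ
  ⟪ a ⟶ b  ⟫ ρ = ⟪ a ⟫ ρ ⇒ᴬ ⟪ b ⟫ ρ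
  ⟪ a □→ b ⟫ ρ = ⟪ a ⟫ ρ □→ᴬ[ F ] ⟪ b ⟫ ρ
  ⟪ 𝟘      ⟫ ρ = ⊥ᴬ
  ⟪ 𝟙      ⟫ ρ = ⊤ᴬ

  ⟪⟫-pointwise : ∀ ρ φ → ⟪ φ ⟫ ρ ≡ (eval (λ ψ → proj₁ (⟪ ψ ⟫ ρ)) φ , eval (λ ψ → proj₂ (⟪ ψ ⟫ ρ)) φ)
  ⟪⟫-pointwise ρ (var x)  = refl
  ⟪⟫-pointwise ρ (a ⋀ b)  = cong₂ _∧ᴬ_ (⟪⟫-pointwise ρ a) (⟪⟫-pointwise ρ b)
  ⟪⟫-pointwise ρ (a ⋁ b)  = cong₂ _∨ᴬ_ (⟪⟫-pointwise ρ a) (⟪⟫-pointwise ρ b)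
  ⟪⟫-pointwise ρ (a ⟶ b)  = cong₂ _⇒ᴬ_ (⟪⟫-pointwise ρ a) (⟪⟫-pointwise ρ b)
  ⟪⟫-pointwise ρ (a □→ b) = refl
  ⟪⟫-pointwise ρ 𝟘        = refl
  ⟪⟫-pointwise ρ 𝟙        = refl

  tautology-valid : ∀ {φ} → Tautology φ → ∀ ρ → ⟪ φ ⟫ ρ ≡ ⊤ᴬ
  tautology-valid {φ} t ρ = trans (⟪⟫-pointwise ρ φ) (cong₂ _,_ (t _) (t _))

  ⟪sub⟫-cong : ∀ {V} {σ τ : V → Form} ρ → (∀ k → ⟪ σ k ⟫ ρ ≡ ⟪ τ k ⟫ ρ) →
               ∀ e → ⟪ sub σ e ⟫ ρ ≡ ⟪ sub τ e ⟫ ρ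
  ⟪sub⟫-cong ρ eq (var k)  = eq k
  ⟪sub⟫-cong ρ eq (a ⋀ b)  = cong₂ _∧ᴬ_ (⟪sub⟫-cong ρ eq a) (⟪sub⟫-cong ρ eq b)
  ⟪sub⟫-cong ρ eq (a ⋁ b)  = cong₂ _∨ᴬ_ (⟪sub⟫-cong ρ eq a) (⟪sub⟫-cong ρ eq b)
  ⟪sub⟫-cong ρ eq (a ⟶ b)  = cong₂ _⇒ᴬ_ (⟪sub⟫-cong ρ eq a) (⟪sub⟫-cong ρ eq b)
  ⟪sub⟫-cong ρ eq (a □→ b) = cong₂ _□→ᴬ[ F ]_ (⟪sub⟫-cong ρ eq a) (⟪sub⟫-cong ρ eq b)
  ⟪sub⟫-cong ρ eq 𝟘        = refl
  ⟪sub⟫-cong ρ eq 𝟙        = refl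

  assign : 𝔸 → 𝔸 → 𝔸 → ℕ → 𝔸
  assign a b c 0 = a
  assign a b c 1 = b
  assign a b c _ = c

  Valid : Form → Set
  Valid φ = ∀ a b c → ⟪ φ ⟫ (assign a b c) ≡ ⊤ᴬ

  valid? : ∀ φ → Dec (Valid φ)
  valid? φ = ∀-𝔸? λ a → ∀-𝔸? λ b → ∀-𝔸? λ c → ⟪ φ ⟫ (assign a b c) ≟ᴬ ⊤ᴬ

v₀ v₁ v₂ : Form
v₀ = var 0
v₁ = var 1
v₂ = var 2

LV-schema-valid : ∀ {φ} → LVAx φ → {True (∀-Frame? λ F → Semantics.valid? F φ)} →
                  ∀ F → Semantics.Valid F φ
LV-schema-valid _ {v} = toWitness v

schema : (a : Ax) → Σ Form (AxInst a)
schema W = -, W-inst v₀ v₁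
schema C = -, C-inst v₀ v₁
schema N = -, N-inst v₀
schema T = -, T-inst v₀
schema S = -, S-inst v₀ v₁
schema U = -, U-inst v₀
schema A = -, A-inst v₀ v₁

validates : Frame → Ax → Bool
validates F a = does (Semantics.valid? F (proj₁ (schema a)))

module _ (F : Frame) where
  open Semantics F

  LV-valid : ∀ {φ} → LVAx φ → ∀ ρ → ⟪ φ ⟫ ρ ≡ ⊤ᴬ
  LV-valid (taut {φ} t) ρ = tautology-valid {φ} t ρ
  LV-valid (L1 φ)       ρ = LV-schema-valid (L1 v₀) F (⟪ φ ⟫ ρ) ⊤ᴬ ⊤ᴬ
  LV-valid (L2 φ ψ γ)   ρ = LV-schema-valid (L2 v₀ v₁ v₂) F (⟪ φ ⟫ ρ) (⟪ ψ ⟫ ρ) (⟪ γ ⟫ ρ)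
  LV-valid (L3 φ ψ γ)   ρ = LV-schema-valid (L3 v₀ v₁ v₂) F (⟪ φ ⟫ ρ) (⟪ ψ ⟫ ρ) (⟪ γ ⟫ ρ)
  LV-valid (L4 φ ψ γ)   ρ = LV-schema-valid (L4 v₀ v₁ v₂) F (⟪ φ ⟫ ρ) (⟪ ψ ⟫ ρ) (⟪ γ ⟫ ρ)

  instance-valid : ∀ {a φ} → Valid (proj₁ (schema a)) → AxInst a φ → ∀ ρ → ⟪ φ ⟫ ρ ≡ ⊤ᴬ
  instance-valid v (W-inst φ ψ) ρ = v (⟪ φ ⟫ ρ) (⟪ ψ ⟫ ρ) ⊤ᴬ
  instance-valid v (C-inst φ ψ) ρ = v (⟪ φ ⟫ ρ) (⟪ ψ ⟫ ρ) ⊤ᴬ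
  instance-valid v (N-inst φ)   ρ = v (⟪ φ ⟫ ρ) ⊤ᴬ ⊤ᴬ
  instance-valid v (T-inst φ)   ρ = v (⟪ φ ⟫ ρ) ⊤ᴬ ⊤ᴬ
  instance-valid v (S-inst φ ψ) ρ = v (⟪ φ ⟫ ρ) (⟪ ψ ⟫ ρ) ⊤ᴬ
  instance-valid v (U-inst φ)   ρ = v (⟪ φ ⟫ ρ) ⊤ᴬ ⊤ᴬ
  instance-valid v (A-inst φ ψ) ρ = v (⟪ φ ⟫ ρ) (⟪ ψ ⟫ ρ) ⊤ᴬ

  axiom-valid : ∀ {X : Ax → Bool} → (∀ a → validates F a ≡ false → X a ≡ false) →
                ∀ {a φ} → X a ≡ true → AxInst a φ → ∀ ρ → ⟪ φ ⟫ ρ ≡ ⊤ᴬ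
  axiom-valid avoids {a} x with valid? (proj₁ (schema a)) in eq
  ... | yes v = instance-valid v
  ... | no _ with () ← trans (sym x) (avoids a (cong does eq))

record Filter : Set₁ where
  field
    Member    : 𝔸 → Set
    ⊤-member  : Member ⊤ᴬ
    mp-closed : ∀ {a b} → Member a → Member (a ⇒ᴬ b) → Member b

  top-member : ∀ {a} → a ≡ ⊤ᴬ → Member a
  top-member refl = ⊤-member

open Filter

top-filter : Filter
top-filter = record { Member = _≡ ⊤ᴬ ; ⊤-member = refl ; mp-closed = λ { refl b → b } }

world₁-filter : Filter
world₁-filter = record { Member = λ a → proj₁ a ≡ true ; ⊤-member = refl ; mp-closed = λ { refl b → b } }

-- Refuting algebraizability through the Leibniz congruence

module NotAlgebraizable (F : Frame) {X : Ax → Bool}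
  (avoids : ∀ a → validates F a ≡ false → X a ≡ false) where

  open Semantics F

  sound : ∀ G {Γ φ} → Deriv X Γ φ → ∀ ρ → (∀ {ψ} → Γ ψ → Member G (⟪ ψ ⟫ ρ)) → Member G (⟪ φ ⟫ ρ)
  sound G (hyp h)       ρ Γ⊆G = Γ⊆G h
  sound G (base l)      ρ _   = top-member G (LV-valid F l ρ)
  sound G (extra a x i) ρ _   = top-member G (axiom-valid F avoids x i ρ)
  sound G (mp d e)      ρ Γ⊆G = mp-closed G (sound G d ρ Γ⊆G) (sound G e ρ Γ⊆G)
  sound G (rck d)       ρ _   = top-member G (□→ᴬ-monotone F _ _ _ (sound top-filter d ρ λ ()))

  _⟨_⟩ : Fm (Fin 1) → Form → Form
  e ⟨ φ ⟩ = sub (λ _ → φ) e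

  module _ (alg : Algebraizable X) where

    open Algebraizable alg

    module Congruence (G : Filter) (ρ : ℕ → 𝔸) where

      infix 4 _≈_
      _≈_ : Form → Form → Set
      φ ≈ ψ = ∀ i → Member G (⟪ sub (σ₂ φ ψ) (Δ i) ⟫ ρ)

      members : ∀ {φ ψ χ} → φ ≈ ψ → Δ[ φ , ψ ] χ → Member G (⟪ χ ⟫ ρ)
      members φ≈ψ (i , refl) = φ≈ψ i

      ≈-refl : ∀ φ → φ ≈ φ
      ≈-refl φ i = sound G (refl-Δ φ i) ρ λ ()

      ≈-sym : ∀ {φ ψ} → φ ≈ ψ → ψ ≈ φ
      ≈-sym φ≈ψ i = sound G (sym-Δ _ _ i) ρ (members φ≈ψ)

      ≈-trans : ∀ {φ ψ χ} → φ ≈ ψ → ψ ≈ χ → φ ≈ χ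
      ≈-trans φ≈ψ ψ≈χ i = sound G (trans-Δ _ _ _ i) ρ [ members φ≈ψ , members ψ≈χ ]

      ≈-cong : ∀ o {φ₁ ψ₁ φ₂ ψ₂} → φ₁ ≈ ψ₁ → φ₂ ≈ ψ₂ → app o φ₁ φ₂ ≈ app o ψ₁ ψ₂
      ≈-cong o p q i = sound G (cong-Δ o _ _ _ _ i) ρ [ members p , members q ]

      ≈-subst : ∀ e {φ ψ} → φ ≈ ψ → e ⟨ φ ⟩ ≈ e ⟨ ψ ⟩
      ≈-subst (var _)  p = p
      ≈-subst (a ⋀ b)  p = ≈-cong and (≈-subst a p) (≈-subst b p)
      ≈-subst (a ⋁ b)  p = ≈-cong or  (≈-subst a p) (≈-subst b p)
      ≈-subst (a ⟶ b)  p = ≈-cong imp (≈-subst a p) (≈-subst b p)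
      ≈-subst (a □→ b) p = ≈-cong cf  (≈-subst a p) (≈-subst b p)
      ≈-subst 𝟘        p = ≈-refl 𝟘
      ≈-subst 𝟙        p = ≈-refl 𝟙

      ≡⇒≈ : ∀ {φ ψ} → ⟪ φ ⟫ ρ ≡ ⟪ ψ ⟫ ρ → φ ≈ ψ
      ≡⇒≈ {φ} eq i =
        subst (Member G) (⟪sub⟫-cong ρ (λ { zero → refl ; (suc zero) → eq }) (Δ i)) (≈-refl φ i)

      member⇒E : ∀ {φ} → Member G (⟪ φ ⟫ ρ) → ∀ j → proj₁ (E j) ⟨ φ ⟩ ≈ proj₂ (E j) ⟨ φ ⟩
      member⇒E φ∈G j i = sound G (alg₁ _ _ (j , i , refl)) ρ λ { refl → φ∈G }

      E⇒member : ∀ {φ} → (∀ j → proj₁ (E j) ⟨ φ ⟩ ≈ proj₂ (E j) ⟨ φ ⟩) → Member G (⟪ φ ⟫ ρ)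
      E⇒member E-φ = sound G (alg₂ _) ρ λ { (j , i , refl) → E-φ j i }

      member-resp-≈ : ∀ {φ ψ} → φ ≈ ψ → Member G (⟪ φ ⟫ ρ) → Member G (⟪ ψ ⟫ ρ)
      member-resp-≈ φ≈ψ φ∈G = E⇒member λ j →
        ≈-trans (≈-sym (≈-subst (proj₁ (E j)) φ≈ψ))
                (≈-trans (member⇒E φ∈G j) (≈-subst (proj₂ (E j)) φ≈ψ))

    ρ₀ : ℕ → 𝔸
    ρ₀ _ = true , false

    module W₁ = Congruence world₁-filter ρ₀
    module Top = Congruence top-filter ρ₀

    W₁-≈⇒≡ : ∀ {φ ψ} → φ W₁.≈ ψ → ⟪ φ ⟫ ρ₀ ≡ ⟪ ψ ⟫ ρ₀
    W₁-≈⇒≡ {φ} {ψ} φ≈ψ = cong₂ _,_ (at-world₁ φ≈ψ) at-world₂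
      where
      at-world₁ : ∀ {φ ψ} → φ W₁.≈ ψ → proj₁ (⟪ φ ⟫ ρ₀) ≡ proj₁ (⟪ ψ ⟫ ρ₀)
      at-world₁ p = ⇔→≡ (mk⇔ (W₁.member-resp-≈ p) (W₁.member-resp-≈ (W₁.≈-sym p)))
      -- ⟪ ~ v₀ ⟫ ρ₀ is the proposition {world 2}.
      at-world₂ : proj₂ (⟪ φ ⟫ ρ₀) ≡ proj₂ (⟪ ψ ⟫ ρ₀)
      at-world₂ = trans (sym (□→ᴬ-world₂ F _))
        (trans (at-world₁ (W₁.≈-cong cf (W₁.≈-refl (~ v₀)) φ≈ψ)) (□→ᴬ-world₂ F _))

    absurd : ⊥
    absurd = ρ₀-not-top (Top.E⇒member {v₀} λ j → Top.≡⇒≈ (W₁-≈⇒≡ (W₁.member⇒E refl j)))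
      where
      ρ₀-not-top : ¬ (ρ₀ 0 ≡ ⊤ᴬ)
      ρ₀-not-top ()

¬algebraizable : ∀ F {X} → (∀ a → validates F a ≡ false → X a ≡ false) → ¬ Algebraizable X
¬algebraizable F avoids alg = NotAlgebraizable.absurd F avoids alg

¬algebraizable-without-A : ∀ {X} → X A ≡ false → ¬ Algebraizable X
¬algebraizable-without-A a = ¬algebraizable (closer₁ , closer₂)
  λ { A _ → a ; W () ; C () ; N () ; T () ; S () ; U () }

¬algebraizable-without-C-S : ∀ {X} → X C ≡ false → X S ≡ false → ¬ Algebraizable X
¬algebraizable-without-C-S c s = ¬algebraizable (tie , tie)
  λ { C _ → c ; S _ → s ; W () ; N () ; T () ; U () ; A () }

¬algebraizable-without-C-W : ∀ {X} → X C ≡ false → X W ≡ false → ¬ Algebraizable X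
¬algebraizable-without-C-W c w = ¬algebraizable (closer₁ , closer₁)
  λ { C _ → c ; W _ → w ; N () ; T () ; S () ; U () ; A () }

theorem4p24 : Algebraizable CA × ((X : Ax → Bool) → Algebraizable X → SameLogic X CA)
theorem4p24 = CA-Extension.algebraizable (extra C refl) (extra A refl) , only-LVCA
  where
  only-LVCA : (X : Ax → Bool) → Algebraizable X → SameLogic X CA
  only-LVCA X alg with X A in a | X C in c | X W in w | X S in s
  ... | false | _     | _     | _     = ⊥-elim (¬algebraizable-without-A a alg)
  ... | true  | true  | _     | _     = same-logic-as-LVCA (extra C c) (extra A a)
  ... | true  | false | true  | true  = same-logic-as-LVCA (C-from-W-S w s) (extra A a)
  ... | true  | false | _     | false = ⊥-elim (¬algebraizable-without-C-S c s alg)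
  ... | true  | false | false | true  = ⊥-elim (¬algebraizable-without-C-W c w alg)
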